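{- Let $\varepsilon\in\{1,-1\}$ and let $(\alpha,\beta,\gamma)\in\mathbb{Z}[i]^3$ satisfy $\alpha^2+(1+\varepsilon i)\beta^2+\gamma^2=0$, $\alpha\beta\gamma\neq0$ and $\gcd(\alpha,\beta,\gamma)\in U$. Then $\beta\equiv 0\pmod{(1+i)^2}$.
   Context: $\mathbb{Z}[i]$ is the ring of Gaussian integers and $U=\{1,-1,i,-i\}$ its unit group. Congruences modulo $\mu$ mean divisibility by $\mu$ in $\mathbb{Z}[i]$; "$\gcd\in U$" means no common non-unit divisor. -}

module Defs where

open import Data.Integer using (ℤ; +_; -[1+_]) renaming (_+_ to _+ℤ_; _*_ to _*ℤ_; -_ to -ℤ_; _-_ to _-ℤ_)
open import Data.Product using (Σ; _×_; _,_)
open import Data.Sum using (_⊎_)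
open import Relation.Binary.PropositionalEquality using (_≡_)
open import Relation.Nullary using (¬_)

record ℤ[i] : Set where
  constructor _+_i
  field
    re : ℤ
    im : ℤ
open ℤ[i] public

infixl 6 _+ᵍ_
infixl 7 _*ᵍ_

_+ᵍ_ : ℤ[i] → ℤ[i] → ℤ[i]
(a + b i) +ᵍ (c + d i) = (a +ℤ c) + (b +ℤ d) i

_*ᵍ_ : ℤ[i] → ℤ[i] → ℤ[i]
(a + b i) *ᵍ (c + d i) = ((a *ℤ c) -ℤ (b *ℤ d)) + ((a *ℤ d) +ℤ (b *ℤ c)) i

0ᵍ 1ᵍ iᵍ : ℤ[i]
0ᵍ = (+ 0) + (+ 0) i
1ᵍ = (+ 1) + (+ 0) i
iᵍ = (+ 0) + (+ 1) i

-ᵍ_ : ℤ[i] → ℤ[i]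
-ᵍ (a + b i) = (-ℤ a) + (-ℤ b) i

_∣ᵍ_ : ℤ[i] → ℤ[i] → Set
μ ∣ᵍ x = Σ ℤ[i] λ q → x ≡ q *ᵍ μ

data InU : ℤ[i] → Set where
  u1  : InU 1ᵍ
  u-1 : InU (-ᵍ 1ᵍ)
  ui  : InU iᵍ
  u-i : InU (-ᵍ iᵍ)

-- gcd(α,β,γ) ∈ U : every common divisor is a unit
GcdUnit : ℤ[i] → ℤ[i] → ℤ[i] → Set
GcdUnit α β γ = ∀ δ → δ ∣ᵍ α → δ ∣ᵍ β → δ ∣ᵍ γ → InU δ

-- Modulo 4 the form depends only on the residues of ε and of the coordinates, so the claim
-- reduces to a finite check.  The reason it holds: squares in ℤ[i] modulo 4 lie in
-- {0, 1, -1, 2i}, the last three occurring exactly when the element is not divisible by 2.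
-- For odd ε, if 2 ∤ β then (1 + εi)β² is congruent to ±(1 + εi) or 2 + 2i modulo 4, while a
-- sum of two squares has even imaginary part and is never 2 + 2i; so the form cannot vanish.
-- Hence 2, an associate of (1 + i)², divides β.
module Submission where

open import Defs
open import Data.Integer using (ℤ; +_; -[1+_]; _+_; _*_; _-_; -_)
open import Data.Integer.Divisibility.Signed
  using (_∣_; divides; _∣?_; ∣-trans; ∣m∣n⇒∣m+n; ∣m⇒∣-m; ∣n⇒∣m*n; ∣m⇒∣m*n)
open import Data.Integer.DivMod using (_%ℕ_; _/ℕ_; a≡a%ℕn+[a/ℕn]*n; n%ℕd<d)
open import Data.Integer.Properties using (+-inverseʳ; +-identityʳ)
open import Data.Integer.Tactic.RingSolver using (solve-∀)
import Data.Nat as ℕ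
open import Data.Nat using (NonZero)
open import Data.Fin using (Fin; fromℕ<; toℕ)
open import Data.Fin.Properties using (all?; toℕ-fromℕ<)
open import Data.Product using (Σ; _×_; _,_; proj₁; proj₂; uncurry)
open import Data.Sum using (_⊎_; inj₁; inj₂)
open import Relation.Binary.PropositionalEquality using (_≡_; refl; sym; cong₂; subst)
open import Relation.Nullary using (¬_; Dec)
open import Relation.Nullary.Decidable using (map′; toWitness; _×-dec_; _→-dec_)

infix 4 _≡_mod_ _≡ᵍ_mod_ _≟_mod_

record _≡_mod_ (x y m : ℤ) : Set where
  constructor ≡-mod
  field
    ∣-difference : m ∣ x - y

mod-refl : ∀ {m} x → x ≡ x mod m
mod-refl x = ≡-mod (divides (+ 0) (+-inverseʳ x))

mod-sym : ∀ {m x y} → x ≡ y mod m → y ≡ x mod m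
mod-sym {x = x} {y} (≡-mod p) = ≡-mod (subst (_ ∣_) (neg-diff x y) (∣m⇒∣-m p))
  where
  neg-diff : ∀ x y → - (x - y) ≡ y - x
  neg-diff = solve-∀

mod-trans : ∀ {m x y z} → x ≡ y mod m → y ≡ z mod m → x ≡ z mod m
mod-trans {x = x} {y} {z} (≡-mod p) (≡-mod q) = ≡-mod (subst (_ ∣_) (telescope x y z) (∣m∣n⇒∣m+n p q))
  where
  telescope : ∀ x y z → (x - y) + (y - z) ≡ x - z
  telescope = solve-∀

mod-weaken : ∀ {k m x y} → k ∣ m → x ≡ y mod m → x ≡ y mod k
mod-weaken k∣m (≡-mod p) = ≡-mod (∣-trans k∣m p)

+-cong-mod : ∀ {m x x′ y y′} → x ≡ x′ mod m → y ≡ y′ mod m → x + y ≡ x′ + y′ mod m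
+-cong-mod {x = x} {x′} {y} {y′} (≡-mod p) (≡-mod q) = ≡-mod (subst (_ ∣_) (regroup x x′ y y′) (∣m∣n⇒∣m+n p q))
  where
  regroup : ∀ x x′ y y′ → (x - x′) + (y - y′) ≡ (x + y) - (x′ + y′)
  regroup = solve-∀

-‿cong-mod : ∀ {m x x′ y y′} → x ≡ x′ mod m → y ≡ y′ mod m → x - y ≡ x′ - y′ mod m
-‿cong-mod {x = x} {x′} {y} {y′} (≡-mod p) (≡-mod q) =
  ≡-mod (subst (_ ∣_) (regroup x x′ y y′) (∣m∣n⇒∣m+n p (∣m⇒∣-m q)))
  where
  regroup : ∀ x x′ y y′ → (x - x′) + - (y - y′) ≡ (x - y) - (x′ - y′)
  regroup = solve-∀

*-cong-mod : ∀ {m x x′ y y′} → x ≡ x′ mod m → y ≡ y′ mod m → x * y ≡ x′ * y′ mod m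
*-cong-mod {x = x} {x′} {y} {y′} (≡-mod p) (≡-mod q) =
  ≡-mod (subst (_ ∣_) (regroup x x′ y y′) (∣m∣n⇒∣m+n (∣m⇒∣m*n y p) (∣n⇒∣m*n x′ q)))
  where
  regroup : ∀ x x′ y y′ → (x - x′) * y + x′ * (y - y′) ≡ x * y - x′ * y′
  regroup = solve-∀

≡0-mod⇒∣ : ∀ {m x} → x ≡ + 0 mod m → m ∣ x
≡0-mod⇒∣ {x = x} (≡-mod p) = subst (_ ∣_) (+-identityʳ x) p

_≟_mod_ : ∀ x y m → Dec (x ≡ y mod m)
x ≟ y mod m = map′ ≡-mod _≡_mod_.∣-difference (m ∣? x - y)

toℤ : ∀ {n} → Fin n → ℤ
toℤ r = + toℕ r

≡-remainder-mod : ∀ {m} x r q → x ≡ r + q * m → x ≡ r mod m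
≡-remainder-mod {m} x r q refl = ≡-mod (divides q (cancel r q m))
  where
  cancel : ∀ r q m → r + q * m - r ≡ q * m
  cancel = solve-∀

residue : ∀ n .{{_ : NonZero n}} x → Σ (Fin n) λ r → x ≡ toℤ r mod + n
residue n x = fromℕ< x%n<n , subst (λ r → x ≡ + r mod + n) (sym (toℕ-fromℕ< x%n<n))
  (≡-remainder-mod x (+ (x %ℕ n)) (x /ℕ n) (a≡a%ℕn+[a/ℕn]*n x n))
  where
  x%n<n : x %ℕ n ℕ.< n
  x%n<n = n%ℕd<d x n

record _≡ᵍ_mod_ (x y : ℤ[i]) (m : ℤ) : Set where
  constructor ⟨_,_⟩
  field
    re-≡ : re x ≡ re y mod m
    im-≡ : im x ≡ im y mod m

mod-reflᵍ : ∀ {m} x → x ≡ᵍ x mod m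
mod-reflᵍ (a + b i) = ⟨ mod-refl a , mod-refl b ⟩

mod-reflexiveᵍ : ∀ {m x y} → x ≡ y → x ≡ᵍ y mod m
mod-reflexiveᵍ {x = x} refl = mod-reflᵍ x

mod-transᵍ : ∀ {m x y z} → x ≡ᵍ y mod m → y ≡ᵍ z mod m → x ≡ᵍ z mod m
mod-transᵍ ⟨ pa , pb ⟩ ⟨ qa , qb ⟩ = ⟨ mod-trans pa qa , mod-trans pb qb ⟩

+ᵍ-cong-mod : ∀ {m x x′ y y′} → x ≡ᵍ x′ mod m → y ≡ᵍ y′ mod m → x +ᵍ y ≡ᵍ x′ +ᵍ y′ mod m
+ᵍ-cong-mod {x = _ + _ i} {_ + _ i} {_ + _ i} {_ + _ i} ⟨ pa , pb ⟩ ⟨ pc , pd ⟩ =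
  ⟨ +-cong-mod pa pc , +-cong-mod pb pd ⟩

*ᵍ-cong-mod : ∀ {m x x′ y y′} → x ≡ᵍ x′ mod m → y ≡ᵍ y′ mod m → x *ᵍ y ≡ᵍ x′ *ᵍ y′ mod m
*ᵍ-cong-mod {x = _ + _ i} {_ + _ i} {_ + _ i} {_ + _ i} ⟨ pa , pb ⟩ ⟨ pc , pd ⟩ =
  ⟨ -‿cong-mod (*-cong-mod pa pc) (*-cong-mod pb pd) , +-cong-mod (*-cong-mod pa pd) (*-cong-mod pb pc) ⟩

-- (1 + i)² = 2i, so a + bi = (b/2 - (a/2) i) · 2i.
≡0-mod2⇒[1+i]²∣ᵍ : ∀ {a b} → a ≡ + 0 mod + 2 → b ≡ + 0 mod + 2 → ((1ᵍ +ᵍ iᵍ) *ᵍ (1ᵍ +ᵍ iᵍ)) ∣ᵍ (a + b i)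
≡0-mod2⇒[1+i]²∣ᵍ a≡0 b≡0 with ≡0-mod⇒∣ a≡0 | ≡0-mod⇒∣ b≡0
... | divides p refl | divides q refl = q + (- p) i , cong₂ _+_i (re-eq p q) (im-eq p q)
  where
  re-eq : ∀ p q → p * + 2 ≡ q * + 0 - (- p) * + 2
  re-eq = solve-∀
  im-eq : ∀ p q → q * + 2 ≡ q * + 2 + (- p) * + 0
  im-eq = solve-∀

Form : ℤ → ℤ[i] → ℤ[i] → ℤ[i] → ℤ[i]
Form ε α β γ = α *ᵍ α +ᵍ (1ᵍ +ᵍ ((ε + (+ 0) i) *ᵍ iᵍ)) *ᵍ (β *ᵍ β) +ᵍ γ *ᵍ γ

Form-cong-mod : ∀ {m ε ε′ α α′ β β′ γ γ′} → ε ≡ ε′ mod m →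
  α ≡ᵍ α′ mod m → β ≡ᵍ β′ mod m → γ ≡ᵍ γ′ mod m → Form ε α β γ ≡ᵍ Form ε′ α′ β′ γ′ mod m
Form-cong-mod {m} {ε} {ε′} ε≡ α≡ β≡ γ≡ =
  +ᵍ-cong-mod (+ᵍ-cong-mod (*ᵍ-cong-mod α≡ α≡) (*ᵍ-cong-mod unit≡ (*ᵍ-cong-mod β≡ β≡))) (*ᵍ-cong-mod γ≡ γ≡)
  where
  unit≡ : 1ᵍ +ᵍ (ε + (+ 0) i) *ᵍ iᵍ ≡ᵍ 1ᵍ +ᵍ (ε′ + (+ 0) i) *ᵍ iᵍ mod m
  unit≡ = +ᵍ-cong-mod (mod-reflᵍ 1ᵍ) (*ᵍ-cong-mod {x = ε + (+ 0) i} {ε′ + (+ 0) i} ⟨ ε≡ , mod-refl (+ 0) ⟩ (mod-reflᵍ iᵍ))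

Form≡0-mod4⇒even-on-residues : ∀ (ε a b c d e f : Fin 4) → toℤ ε ≡ + 1 mod + 2 →
  let φ = Form (toℤ ε) (toℤ a + toℤ b i) (toℤ c + toℤ d i) (toℤ e + toℤ f i) in
  re φ ≡ + 0 mod + 4 → im φ ≡ + 0 mod + 4 → (toℤ c ≡ + 0 mod + 2) × (toℤ d ≡ + 0 mod + 2)
Form≡0-mod4⇒even-on-residues = toWitness {a? =
  all? λ ε → all? λ a → all? λ b → all? λ c → all? λ d → all? λ e → all? λ f →
    let φ = Form (toℤ ε) (toℤ a + toℤ b i) (toℤ c + toℤ d i) (toℤ e + toℤ f i) in
    (toℤ ε ≟ + 1 mod + 2) →-dec (re φ ≟ + 0 mod + 4) →-dec (im φ ≟ + 0 mod + 4) →-dec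
    (toℤ c ≟ + 0 mod + 2) ×-dec (toℤ d ≟ + 0 mod + 2)} _

2∣4 : + 2 ∣ + 4
2∣4 = divides (+ 2) refl

Form≡0-mod4⇒even : ∀ {ε} → ε ≡ + 1 mod + 2 → ∀ α β γ → Form ε α β γ ≡ᵍ 0ᵍ mod + 4 →
  (re β ≡ + 0 mod + 2) × (im β ≡ + 0 mod + 2)
Form≡0-mod4⇒even {ε} ε-odd α β γ form≡0
  with residue 4 ε | residue 4 (re α) | residue 4 (im α) | residue 4 (re β) | residue 4 (im β)
     | residue 4 (re γ) | residue 4 (im γ)
... | rε , ε≡ | ra , a≡ | rb , b≡ | rc , c≡ | rd , d≡ | re′ , e≡ | rf , f≡ =
  mod-trans (mod-weaken 2∣4 c≡) (proj₁ residues-even) , mod-trans (mod-weaken 2∣4 d≡) (proj₂ residues-even)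
  where
  reduced : Form (toℤ rε) (toℤ ra + toℤ rb i) (toℤ rc + toℤ rd i) (toℤ re′ + toℤ rf i) ≡ᵍ 0ᵍ mod + 4
  reduced = mod-transᵍ
    (Form-cong-mod (mod-sym ε≡) ⟨ mod-sym a≡ , mod-sym b≡ ⟩ ⟨ mod-sym c≡ , mod-sym d≡ ⟩ ⟨ mod-sym e≡ , mod-sym f≡ ⟩)
    form≡0
  residues-even : (toℤ rc ≡ + 0 mod + 2) × (toℤ rd ≡ + 0 mod + 2)
  residues-even = Form≡0-mod4⇒even-on-residues rε ra rb rc rd re′ rf
    (mod-trans (mod-weaken 2∣4 (mod-sym ε≡)) ε-odd) (_≡ᵍ_mod_.re-≡ reduced) (_≡ᵍ_mod_.im-≡ reduced)

Form≡0⇒[1+i]²∣ᵍ : ∀ {ε} → ε ≡ + 1 mod + 2 → ∀ α β γ → Form ε α β γ ≡ 0ᵍ → ((1ᵍ +ᵍ iᵍ) *ᵍ (1ᵍ +ᵍ iᵍ)) ∣ᵍ β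
Form≡0⇒[1+i]²∣ᵍ ε-odd α β γ form≡0 =
  uncurry ≡0-mod2⇒[1+i]²∣ᵍ (Form≡0-mod4⇒even ε-odd α β γ (mod-reflexiveᵍ form≡0))

±1-odd : ∀ {ε} → ε ≡ + 1 ⊎ ε ≡ -[1+ 0 ] → ε ≡ + 1 mod + 2
±1-odd (inj₁ refl) = mod-refl (+ 1)
±1-odd (inj₂ refl) = ≡-mod (divides -[1+ 0 ] refl)

lemma4p12 : (ε : ℤ) → (ε ≡ + 1 ⊎ ε ≡ -[1+ 0 ]) →
    (α β γ : ℤ[i]) →
    α *ᵍ α +ᵍ (1ᵍ +ᵍ ((ε + (+ 0) i) *ᵍ iᵍ)) *ᵍ (β *ᵍ β) +ᵍ γ *ᵍ γ ≡ 0ᵍ →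
    ¬ (α *ᵍ β *ᵍ γ ≡ 0ᵍ) →
    GcdUnit α β γ →
    ((1ᵍ +ᵍ iᵍ) *ᵍ (1ᵍ +ᵍ iᵍ)) ∣ᵍ β
lemma4p12 ε ε≡±1 α β γ form≡0 _ _ = Form≡0⇒[1+i]²∣ᵍ (±1-odd ε≡±1) α β γ form≡0
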